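{- Let $(G,\sigma)$ be an undirected graph with vertex-coloring $\sigma$. Then $(G,\sigma)$ is a un2qBMG if and only if there exists a tree $(T,\sigma,u)$ that explains $G$.
   Context: All trees are rooted (root $\rho$, arcs directed from parents to children) and phylogenetic (every non-leaf vertex has at least two children); $L(T)$ is the leaf set. For vertices $a,b$ of $T$, $a\preceq b$ means $a$ is a descendant of $b$ or $a=b$; $\mathrm{lca}(x,y)$ is the last common ancestor of $x,y$. A leaf-coloring is a map $\sigma$ from $L(T)$ to a set of two colors. A truncation map $u$ assigns to each leaf $x$ a vertex $u(x)$ on the path from $\rho$ to $x$. A leaf $y$ is a quasi-best match of a leaf $x$ in $(T,\sigma,u)$ if $\sigma(y)\neq\sigma(x)$, $\mathrm{lca}(x,y)\preceq \mathrm{lca}(x,z)$ for all leaves $z$ with $\sigma(z)=\sigma(y)$, and $\mathrm{lca}(x,y)\preceq u(x)$. The 2-colored quasi-best match graph (2qBMG) of $(T,\sigma,u)$ is the digraph on $L(T)$ with an arc $x\to y$ iff $y$ is a quasi-best match of $x$ (with $\sigma$ using exactly two colors). A vertex-colored undirected graph $(G,\sigma)$ is a un2qBMG if it is the underlying undirected graph of some 2qBMG of a tree $(T,\sigma,u)$ with $L(T)=V(G)$ (i.e. $xy\in E(G)$ iff $x\to y$ or $y\to x$). A tree $(T,\sigma,u)$ with $\sigma$ a leaf-coloring into two colors and $u(x)\in\{x,\rho\}$ for all leaves $x$ explains $G$ if $V(G)=L(T)$ and for leaves $x,y$: $xy\in E(G)$ iff $\sigma(x)\neq\sigma(y)$ and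 either (a) $u(x)\neq x$ and $y\preceq \mathrm{lca}(x,z)$ for all leaves $z$ with $\sigma(z)=\sigma(y)$, or (b) $u(y)\neq y$ and $x\preceq\mathrm{lca}(y,z)$ for all leaves $z$ with $\sigma(z)=\sigma(x)$. -}

module Defs where

open import Data.Nat using (ℕ)
open import Data.Fin using (Fin)
open import Data.Bool using (Bool)
open import Data.Maybe using (Maybe; just; nothing)
open import Data.Product using (Σ; ∃; ∃-syntax; _×_; _,_)
open import Data.Sum using (_⊎_)
open import Relation.Nullary using (¬_)
open import Relation.Binary.PropositionalEquality using (_≡_; _≢_)
open import Function.Bundles using (_⇔_)

-- Rooted trees on the vertex set Fin n, given by a parent map.
-- parent v ≡ just p  means the arc p → v (p is the parent of v).

module _ {n : ℕ} (parent : Fin n → Maybe (Fin n)) where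

  data _⪯_ : Fin n → Fin n → Set where
    ⪯-refl : ∀ {a} → a ⪯ a
    ⪯-step : ∀ {a p b} → parent a ≡ just p → p ⪯ b → a ⪯ b

  ChildOf : Fin n → Fin n → Set
  ChildOf c v = parent c ≡ just v

  IsLeafV : Fin n → Set
  IsLeafV v = ∀ c → ¬ ChildOf c v

  IsLCA : Fin n → Fin n → Fin n → Set
  IsLCA a b w = a ⪯ w × b ⪯ w × (∀ c → a ⪯ c → b ⪯ c → w ⪯ c)

-- A rooted phylogenetic tree with n vertices whose leaf set is
-- identified with Fin m via the injective map `leaf`.
record PhyloTree (m n : ℕ) : Set where
  field
    root      : Fin n
    parent    : Fin n → Maybe (Fin n)
    root-noParent : parent root ≡ nothing
    noParent⇒root : ∀ v → parent v ≡ nothing → v ≡ root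
    reach-root    : ∀ v → _⪯_ parent v root
    phylogenetic  : ∀ v → IsLeafV parent v
                        ⊎ Σ (Fin n) λ c₁ → Σ (Fin n) λ c₂ →
                            c₁ ≢ c₂ × ChildOf parent c₁ v × ChildOf parent c₂ v
    leaf          : Fin m → Fin n
    leaf-injective : ∀ x y → leaf x ≡ leaf y → x ≡ y
    leaf-isLeaf   : ∀ x → IsLeafV parent (leaf x)
    isLeaf⇒leaf   : ∀ v → IsLeafV parent v → ∃[ x ] leaf x ≡ v

module _ {m n : ℕ} (T : PhyloTree m n) where
  open PhyloTree T

  infix 4 _≼_
  _≼_ : Fin n → Fin n → Set
  _≼_ = _⪯_ parent

  lca : Fin n → Fin n → Fin n → Set
  lca = IsLCA parent

  IsTruncation : (Fin m → Fin n) → Set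
  IsTruncation u = ∀ x → leaf x ≼ u x

  QuasiBestMatch : (Fin m → Bool) → (Fin m → Fin n) → Fin m → Fin m → Set
  QuasiBestMatch σ u x y =
    σ y ≢ σ x
    × (∀ z → σ z ≡ σ y → ∀ w w′ → lca (leaf x) (leaf y) w
                                 → lca (leaf x) (leaf z) w′ → w ≼ w′)
    × (∀ w → lca (leaf x) (leaf y) w → w ≼ u x)

  BelowAllLCAs : (Fin m → Bool) → Fin m → Fin m → Set
  BelowAllLCAs σ x y =
    ∀ z → σ z ≡ σ y → ∀ w → lca (leaf x) (leaf z) w → leaf y ≼ w

  Explains : (Fin m → Bool) → (Fin m → Fin n) → (Fin m → Fin m → Set) → Set
  Explains σ u E =
    (∀ x → u x ≡ leaf x ⊎ u x ≡ root)
    × (∀ x y → E x y ⇔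
         (σ x ≢ σ y
          × ((u x ≢ leaf x × BelowAllLCAs σ x y)
             ⊎ (u y ≢ leaf y × BelowAllLCAs σ y x))))

UsesTwoColours : ∀ {m} → (Fin m → Bool) → Set
UsesTwoColours σ = ∀ c → ∃[ x ] σ x ≡ c

IsUn2qBMG : (m : ℕ) → (Fin m → Fin m → Set) → (Fin m → Bool) → Set
IsUn2qBMG m E σ =
  UsesTwoColours σ
  × Σ ℕ λ n → Σ (PhyloTree m n) λ T → Σ (Fin m → Fin n) λ u →
      IsTruncation T u
      × (∀ x y → E x y ⇔ (QuasiBestMatch T σ u x y ⊎ QuasiBestMatch T σ u y x))

ExistsExplainingTree : (m : ℕ) → (Fin m → Fin m → Set) → (Fin m → Bool) → Set
ExistsExplainingTree m E σ =
  Σ ℕ λ n → Σ (PhyloTree m n) λ T → Σ (Fin m → Fin n) λ u → Explains T σ u E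

-- When u x ∈ {x, ρ}, the truncation condition on a quasi-best match y of x
-- reduces to u x ≠ x (lca(x, y) ⪯ x would force y = x), and the best-match
-- condition to y ⪯ lca(x, z) for every leaf z of the colour of y: together,
-- the explanation condition. An arbitrary truncation map collapses to one
-- with values in {x, ρ} without changing any quasi-best match: raise u x to ρ
-- if some leaf y′ of the other colour lies below u x, since then every
-- candidate y already has lca(x, y) ⪯ lca(x, y′) ⪯ u x; lower it to x
-- otherwise, since then x has no quasi-best match at all.
module Submission where

open import Defs
open import Data.Nat using (ℕ)
open import Data.Fin using (Fin; _≟_)
open import Data.Fin.Properties using (any?)
open import Data.Bool using (Bool)
open import Data.Bool.Properties using (¬-not) renaming (_≟_ to _≟ᵇ_)
open import Data.Maybe using (Maybe; just; nothing)
open import Data.Maybe.Properties using (just-injective)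
open import Data.Product using (∃; ∃-syntax; _×_; _,_; proj₂)
open import Data.Sum using (_⊎_; inj₁; inj₂; [_,_]′; map)
open import Data.Sum.Function.Propositional using (_⊎-⇔_)
open import Data.Empty using (⊥-elim)
open import Relation.Nullary using (¬_; Dec; yes; no; contradiction)
open import Relation.Nullary.Decidable using (_×-dec_; ¬?)
open import Relation.Binary.PropositionalEquality
open import Function.Bundles using (_⇔_; mk⇔; Equivalence)
import Function.Properties.Equivalence as ⇔

≢-both⇒≡ : ∀ {a b c : Bool} → b ≢ a → c ≢ a → b ≡ c
≢-both⇒≡ b≢a c≢a = trans (¬-not b≢a) (sym (¬-not c≢a))

module AncestorOrder {n : ℕ} (parent : Fin n → Maybe (Fin n)) where

  infix 4 _⊑_
  _⊑_ : Fin n → Fin n → Set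
  _⊑_ = _⪯_ parent

  ⊑-trans : ∀ {a b c} → a ⊑ b → b ⊑ c → a ⊑ c
  ⊑-trans ⪯-refl b⊑c = b⊑c
  ⊑-trans (⪯-step e a⊑b) b⊑c = ⪯-step e (⊑-trans a⊑b b⊑c)

  parentless-⊑⇒≡ : ∀ {r b} → parent r ≡ nothing → r ⊑ b → r ≡ b
  parentless-⊑⇒≡ _ ⪯-refl = refl
  parentless-⊑⇒≡ e (⪯-step e′ _) with () ← trans (sym e) e′

  ⊑-leaf⇒≡ : ∀ {a ℓ} → IsLeafV parent ℓ → a ⊑ ℓ → a ≡ ℓ
  ⊑-leaf⇒≡ _ ⪯-refl = refl
  ⊑-leaf⇒≡ leaf (⪯-step e p⊑ℓ) with refl ← ⊑-leaf⇒≡ leaf p⊑ℓ = ⊥-elim (leaf _ e)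

  -- Parents are unique, so an ancestor of a other than a is an ancestor of its parent.
  ⊑-parent : ∀ {a p c} → parent a ≡ just p → a ⊑ c → a ≢ c → p ⊑ c
  ⊑-parent _ ⪯-refl a≢c = contradiction refl a≢c
  ⊑-parent e (⪯-step e′ p′⊑c) _ = subst (_⊑ _) (just-injective (trans (sym e′) e)) p′⊑c

  ⊑-dec : ∀ {a r} → parent r ≡ nothing → a ⊑ r → ∀ b → Dec (a ⊑ b)
  ⊑-dec {a} e a⊑r b with a ≟ b
  ... | yes refl = yes ⪯-refl
  ⊑-dec e ⪯-refl b | no r≢b = no λ r⊑b → r≢b (parentless-⊑⇒≡ e r⊑b)
  ⊑-dec e (⪯-step e′ p⊑r) b | no a≢b with ⊑-dec e p⊑r b
  ... | yes p⊑b = yes (⪯-step e′ p⊑b)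
  ... | no p⋢b = no λ a⊑b → p⋢b (⊑-parent e′ a⊑b a≢b)

  -- The lca of a and b is the first ancestor of a that lies above b.
  lca-exists : ∀ {a b r} → parent r ≡ nothing → a ⊑ r → b ⊑ r → ∃ (IsLCA parent a b)
  lca-exists {a} {b} e a⊑r b⊑r with ⊑-dec e b⊑r a
  ... | yes b⊑a = a , ⪯-refl , b⊑a , λ _ a⊑c _ → a⊑c
  lca-exists e ⪯-refl b⊑r | no b⋢r = contradiction b⊑r b⋢r
  lca-exists e (⪯-step e′ p⊑r) b⊑r | no b⋢a
    with w , p⊑w , b⊑w , least ← lca-exists e p⊑r b⊑r =
    w , ⪯-step e′ p⊑w , b⊑w , λ c a⊑c b⊑c →
      least c (⊑-parent e′ a⊑c λ { refl → b⋢a b⊑c }) b⊑c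

module _ {m n : ℕ} (T : PhyloTree m n) where
  open PhyloTree T
  open AncestorOrder parent using (_⊑_; ⊑-trans; ⊑-leaf⇒≡)

  _⊑?_ : ∀ a b → Dec (a ⊑ b)
  a ⊑? b = AncestorOrder.⊑-dec parent root-noParent (reach-root a) b

  lcaOf : ∀ a b → ∃ (IsLCA parent a b)
  lcaOf a b = AncestorOrder.lca-exists parent root-noParent (reach-root a) (reach-root b)

  lca⊑leaf⇒≡ : ∀ {x y w} → IsLCA parent (leaf x) (leaf y) w → w ⊑ leaf x → x ≡ y
  lca⊑leaf⇒≡ {x} (_ , y⊑w , _) w⊑x =
    sym (leaf-injective _ _ (⊑-leaf⇒≡ (leaf-isLeaf x) (⊑-trans y⊑w w⊑x)))

  RootOrLeaf : (Fin m → Fin n) → Set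
  RootOrLeaf u = ∀ x → u x ≡ leaf x ⊎ u x ≡ root

  rootOrLeaf⇒truncation : ∀ {u} → RootOrLeaf u → IsTruncation T u
  rootOrLeaf⇒truncation rl x with rl x
  ... | inj₁ ux≡x = subst (leaf x ⊑_) (sym ux≡x) ⪯-refl
  ... | inj₂ ux≡ρ = subst (leaf x ⊑_) (sym ux≡ρ) (reach-root (leaf x))

  module _ (σ : Fin m → Bool) where

    Closest : Fin m → Fin m → Set
    Closest x y = ∀ z → σ z ≡ σ y → ∀ w w′ → IsLCA parent (leaf x) (leaf y) w
                                            → IsLCA parent (leaf x) (leaf z) w′ → w ⊑ w′

    closest⇔belowAllLCAs : ∀ x y → Closest x y ⇔ BelowAllLCAs T σ x y
    closest⇔belowAllLCAs x y = mk⇔ to from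
      where
      to : Closest x y → BelowAllLCAs T σ x y
      to closest z z~y w′ L′ =
        let w , Lw@(_ , y⊑w , _) = lcaOf (leaf x) (leaf y)
        in ⊑-trans y⊑w (closest z z~y w w′ Lw L′)

      from : BelowAllLCAs T σ x y → Closest x y
      from below z z~y w w′ (_ , _ , least) L′@(x⊑w′ , _) = least w′ x⊑w′ (below z z~y w′ L′)

    Truncated : (Fin m → Fin n) → Fin m → Fin m → Set
    Truncated u x y = ∀ w → IsLCA parent (leaf x) (leaf y) w → w ⊑ u x

    truncated⇔≢leaf : ∀ {u x y} → u x ≡ leaf x ⊎ u x ≡ root → σ y ≢ σ x
                    → Truncated u x y ⇔ u x ≢ leaf x
    truncated⇔≢leaf {u} {x} {y} ux∈xρ y≁x = mk⇔ to from
      where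
      to : Truncated u x y → u x ≢ leaf x
      to truncated ux≡x =
        let w , Lw = lcaOf (leaf x) (leaf y)
        in y≁x (cong σ (sym (lca⊑leaf⇒≡ Lw (subst (w ⊑_) ux≡x (truncated w Lw)))))

      from : u x ≢ leaf x → Truncated u x y
      from ux≢x w _ = [ (λ ux≡x → contradiction ux≡x ux≢x)
                      , (λ ux≡ρ → subst (w ⊑_) (sym ux≡ρ) (reach-root w)) ]′ ux∈xρ

    ExplainedArc : (Fin m → Fin n) → Fin m → Fin m → Set
    ExplainedArc u x y = u x ≢ leaf x × BelowAllLCAs T σ x y

    qbm⇔explainedArc : ∀ {u} → RootOrLeaf u → ∀ x y →
      QuasiBestMatch T σ u x y ⇔ (σ y ≢ σ x × ExplainedArc u x y)
    qbm⇔explainedArc {u} rl x y = mk⇔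
      (λ { (y≁x , closest , truncated) →
           y≁x , Equivalence.to (truncated⇔≢leaf {u} (rl x) y≁x) truncated
               , Equivalence.to (closest⇔belowAllLCAs x y) closest })
      (λ { (y≁x , ux≢x , below) →
           y≁x , Equivalence.from (closest⇔belowAllLCAs x y) below
               , Equivalence.from (truncated⇔≢leaf {u} (rl x) y≁x) ux≢x })

    arcs⇔explainedArcs : ∀ {u} → RootOrLeaf u → ∀ x y →
      (QuasiBestMatch T σ u x y ⊎ QuasiBestMatch T σ u y x)
        ⇔ (σ x ≢ σ y × (ExplainedArc u x y ⊎ ExplainedArc u y x))
    arcs⇔explainedArcs rl x y =
      ⇔.trans (qbm⇔explainedArc rl x y ⊎-⇔ qbm⇔explainedArc rl y x) ≢-factor
      where
      ≢-factor : ∀ {A B : Set} → ((σ y ≢ σ x × A) ⊎ (σ x ≢ σ y × B)) ⇔ (σ x ≢ σ y × (A ⊎ B))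
      ≢-factor = mk⇔
        (λ { (inj₁ (y≁x , a)) → ≢-sym y≁x , inj₁ a ; (inj₂ (x≁y , b)) → x≁y , inj₂ b })
        (λ { (x≁y , inj₁ a) → inj₁ (≢-sym x≁y , a) ; (x≁y , inj₂ b) → inj₂ (x≁y , b) })

    OppositeBelow : (Fin m → Fin n) → Fin m → Set
    OppositeBelow u x = ∃[ y ] σ y ≢ σ x × leaf y ⊑ u x

    oppositeBelow? : ∀ u x → Dec (OppositeBelow u x)
    oppositeBelow? u x = any? λ y → ¬? (σ y ≟ᵇ σ x) ×-dec leaf y ⊑? u x

    collapse : (Fin m → Fin n) → Fin m → Fin n
    collapse u x with oppositeBelow? u x
    ... | yes _ = root
    ... | no _ = leaf x

    collapse-cases : ∀ u x → (¬ OppositeBelow u x × collapse u x ≡ leaf x)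
                           ⊎ (OppositeBelow u x × collapse u x ≡ root)
    collapse-cases u x with oppositeBelow? u x
    ... | yes below = inj₂ (below , refl)
    ... | no ¬below = inj₁ (¬below , refl)

    collapse-rootOrLeaf : ∀ u → RootOrLeaf (collapse u)
    collapse-rootOrLeaf u x = map proj₂ proj₂ (collapse-cases u x)

    qbm⇔qbm-collapse : ∀ {u} → IsTruncation T u → ∀ x y →
      QuasiBestMatch T σ u x y ⇔ QuasiBestMatch T σ (collapse u) x y
    qbm⇔qbm-collapse {u} truncation x y = mk⇔ to from
      where
      to : QuasiBestMatch T σ u x y → QuasiBestMatch T σ (collapse u) x y
      to (y≁x , closest , truncated) with collapse-cases u x
      ... | inj₂ (_ , cx≡ρ) = y≁x , closest , λ w _ → subst (w ⊑_) (sym cx≡ρ) (reach-root w)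
      ... | inj₁ (¬below , _) =
        let w , Lw@(_ , y⊑w , _) = lcaOf (leaf x) (leaf y)
        in contradiction (y , y≁x , ⊑-trans y⊑w (truncated w Lw)) ¬below

      from : QuasiBestMatch T σ (collapse u) x y → QuasiBestMatch T σ u x y
      from (y≁x , closest , truncated) with collapse-cases u x
      ... | inj₂ ((y′ , y′≁x , y′⊑ux) , _) = y≁x , closest , λ w Lw →
        let w′ , L′@(_ , _ , least′) = lcaOf (leaf x) (leaf y′)
        in ⊑-trans (closest y′ (≢-both⇒≡ y′≁x y≁x) w w′ Lw L′)
                   (least′ (u x) (truncation x) y′⊑ux)
      ... | inj₁ (_ , cx≡x) =
        contradiction cx≡x
          (Equivalence.to (truncated⇔≢leaf {collapse u} (inj₁ cx≡x) y≁x) truncated)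

proposition3p2 : (m : ℕ) (E : Fin m → Fin m → Set) (σ : Fin m → Bool)
    → (∀ x y → E x y → E y x)
    → (∀ x → ¬ E x x)
    → UsesTwoColours σ
    → IsUn2qBMG m E σ ⇔ ExistsExplainingTree m E σ
proposition3p2 m E σ _ _ twoColours = mk⇔ to from
  where
  to : IsUn2qBMG m E σ → ExistsExplainingTree m E σ
  to (_ , n , T , u , truncation , arcs) =
    n , T , collapse T σ u , collapse-rootOrLeaf T σ u , λ x y →
      ⇔.trans (arcs x y)
        (⇔.trans (qbm⇔qbm-collapse T σ truncation x y ⊎-⇔ qbm⇔qbm-collapse T σ truncation y x)
                 (arcs⇔explainedArcs T σ (collapse-rootOrLeaf T σ u) x y))

  from : ExistsExplainingTree m E σ → IsUn2qBMG m E σ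
  from (n , T , u , rootOrLeaf , arcs) =
    twoColours , n , T , u , rootOrLeaf⇒truncation T rootOrLeaf , λ x y →
      ⇔.trans (arcs x y) (⇔.sym (arcs⇔explainedArcs T σ rootOrLeaf x y))
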